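{- Let $\mathcal{Z}$ be a zero-set, $A\subseteq\mathbb{Z}_+^2$, and $A_t=\mathcal{T}^t(A)$ for $t\ge0$. Suppose $x,y\in A_t\setminus A$ and $x,y$ are not neighbors (they lie on neither a common row nor a common column). Let $w$ be the unique element of $L^h(x)\cap L^v(y)$ and $z$ the unique element of $L^v(x)\cap L^h(y)$. Then $w\in A_t$ or $z\in A_t$.
   Context: $\mathbb{Z}_+=\{0,1,2,\dots\}$, $\mathbb{N}=\{1,2,\dots\}$. For $a,b\in\mathbb{N}$, $R_{a,b}=([0,a-1]\times[0,b-1])\cap\mathbb{Z}_+^2$; a zero-set is a union of $R_{a,b}$ over a finite $\mathcal{I}\subseteq\mathbb{N}^2$. For $x\in\mathbb{Z}_+^2$, $L^h(x)$ and $L^v(x)$ are the horizontal and vertical lines through $x$ in $\mathbb{Z}_+^2$; $\mathtt{row}(x,A)=|L^h(x)\cap A|$, $\mathtt{col}(x,A)=|L^v(x)\cap A|$. Regular dynamics: $\mathcal{T}(A)=A\cup\{x\notin A:(\mathtt{row}(x,A),\mathtt{col}(x,A))\notin\mathcal{Z}\}$. -}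

module Defs where

open import Data.Nat using (ℕ; _<_; _≤_)
open import Data.Product using (_×_; _,_; ∃-syntax; Σ-syntax)
open import Data.Sum using (_⊎_)
open import Data.List using (List; length)
open import Data.List.Membership.Propositional using (_∈_)
open import Data.List.Relation.Unary.All using (All)
open import Data.List.Relation.Unary.Unique.Propositional using (Unique)
open import Relation.Nullary using (¬_)

Point : Set
Point = ℕ × ℕ

Subset : Set₁
Subset = Point → Set

-- A zero-set is given by a finite index set 𝓘 ⊆ ℕ² (entries ≥ 1),
-- represented as a list of pairs (a , b).
PositiveIndex : List (ℕ × ℕ) → Set
PositiveIndex I = All (λ { (a , b) → 1 ≤ a × 1 ≤ b }) I

-- (r , c) ∈ R_{a,b}  iff  r ≤ a-1 and c ≤ b-1, i.e. r < a and c < b.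
-- Membership in the zero-set is decided via cardinalities of row/column
-- sets which may be infinite (A is arbitrary), so "row(x,A) < a" is
-- expressed as: every duplicate-free list of points of A on L^h(x) has
-- length < a.

RowLt : Subset → Point → ℕ → Set
RowLt A (x₁ , x₂) k =
  (l : List ℕ) → Unique l → All (λ i → A (i , x₂)) l → length l < k

ColLt : Subset → Point → ℕ → Set
ColLt A (x₁ , x₂) k =
  (l : List ℕ) → Unique l → All (λ j → A (x₁ , j)) l → length l < k

InZero : List (ℕ × ℕ) → Subset → Point → Set
InZero I A x = ∃[ a ] ∃[ b ] ((a , b) ∈ I × RowLt A x a × ColLt A x b)

T : List (ℕ × ℕ) → Subset → Subset
T I A x = A x ⊎ (¬ A x × ¬ InZero I A x)

Tᵗ : List (ℕ × ℕ) → ℕ → Subset → Subset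
Tᵗ I ℕ.zero A = A
Tᵗ I (ℕ.suc t) A = T I (Tᵗ I t A)

{-# OPTIONS --safe #-}
-- If w and z were both missing from A_{t+1}, both would be in the zero-set with
-- respect to A_t, witnessed by some (a₁ , b₁) and (a₂ , b₂) in 𝓘. As w shares its row
-- with x and its column with y, while z shares its row with y and its column with x,
-- the larger of a₁ and a₂ puts x or y into the zero-set with respect to A_t. But a
-- point of A_{t+1} ∖ A was added at some step s ≤ t, so it is outside the zero-set
-- with respect to A_s, hence also with respect to the larger set A_t.
module Submission where

open import Defs
open import Data.Nat using (ℕ; _≤_; zero; suc)
open import Data.Nat.Properties using (≤-total; <-≤-trans)
open import Data.Product using (_×_; _,_)
open import Data.Sum using (_⊎_; inj₁; inj₂; [_,_])
open import Data.List using (List)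
open import Data.List.Relation.Unary.All as All using ()
open import Function using (_∘_)
open import Relation.Nullary using (¬_)
open import Relation.Unary using (_⊆_)
open import Relation.Binary.PropositionalEquality using (_≢_)

RowLt-antitone : ∀ {A B : Subset} → A ⊆ B → ∀ p {k} → RowLt B p k → RowLt A p k
RowLt-antitone A⊆B (_ , p₂) row l unique inA = row l unique (All.map (λ {i} → A⊆B {i , p₂}) inA)

ColLt-antitone : ∀ {A B : Subset} → A ⊆ B → ∀ p {k} → ColLt B p k → ColLt A p k
ColLt-antitone A⊆B (p₁ , _) col l unique inA = col l unique (All.map (λ {j} → A⊆B {p₁ , j}) inA)

InZero-antitone : ∀ I {A B : Subset} → A ⊆ B → ∀ p → InZero I B p → InZero I A p
InZero-antitone I {A} {B} A⊆B p (a , b , ab∈I , row , col) =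
  a , b , ab∈I , RowLt-antitone {A} {B} A⊆B p row , ColLt-antitone {A} {B} A⊆B p col

RowLt-mono : ∀ (A : Subset) p {a b} → a ≤ b → RowLt A p a → RowLt A p b
RowLt-mono A (_ , _) a≤b row l unique inA = <-≤-trans (row l unique inA) a≤b

-- RowLt reads only the second coordinate of the point and ColLt only the first,
-- so rows and columns are transferred between x, y, w and z definitionally.
InZero-cross : ∀ I (A : Subset) x₁ x₂ y₁ y₂
  → InZero I A (y₁ , x₂) → InZero I A (x₁ , y₂)
  → InZero I A (x₁ , x₂) ⊎ InZero I A (y₁ , y₂)
InZero-cross I A x₁ x₂ y₁ y₂ (a₁ , b₁ , a₁b₁∈I , row-w , col-w) (a₂ , b₂ , a₂b₂∈I , row-z , col-z)
  with ≤-total a₁ a₂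
... | inj₁ a₁≤a₂ = inj₁ (a₂ , b₂ , a₂b₂∈I , RowLt-mono A (x₁ , x₂) a₁≤a₂ row-w , col-z)
... | inj₂ a₂≤a₁ = inj₂ (a₁ , b₁ , a₁b₁∈I , RowLt-mono A (y₁ , y₂) a₂≤a₁ row-z , col-w)

added⇒¬InZero : ∀ I A t p → Tᵗ I (suc t) A p → ¬ A p → ¬ InZero I (Tᵗ I t A) p
added⇒¬InZero I A t       p (inj₂ (_ , p∉Z)) p∉A = p∉Z
added⇒¬InZero I A zero    p (inj₁ p∈A)       p∉A = λ _ → p∉A p∈A
added⇒¬InZero I A (suc t) p (inj₁ p∈Aₜ₊₁)    p∉A =
  added⇒¬InZero I A t p p∈Aₜ₊₁ p∉A ∘ InZero-antitone I {Tᵗ I t A} {Tᵗ I (suc t) A} inj₁ p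

¬T⇒¬¬InZero : ∀ I A p → ¬ T I A p → ¬ ¬ InZero I A p
¬T⇒¬¬InZero I A p p∉TA p∉Z = p∉TA (inj₂ (p∉TA ∘ inj₁ , p∉Z))

lemma5p1 : (I : List (ℕ × ℕ)) → PositiveIndex I → (A : Subset) → (t : ℕ)
    → (x₁ x₂ y₁ y₂ : ℕ)
    → Tᵗ I t A (x₁ , x₂) → ¬ A (x₁ , x₂)
    → Tᵗ I t A (y₁ , y₂) → ¬ A (y₁ , y₂)
    → x₁ ≢ y₁ → x₂ ≢ y₂
    → ¬ (¬ Tᵗ I t A (y₁ , x₂) × ¬ Tᵗ I t A (x₁ , y₂))
lemma5p1 I _ A zero    x₁ x₂ y₁ y₂ x∈A x∉A _ _ _ _ _ = x∉A x∈A
lemma5p1 I _ A (suc t) x₁ x₂ y₁ y₂ x∈Aₜ₊₁ x∉A y∈Aₜ₊₁ y∉A _ _ (w∉Aₜ₊₁ , z∉Aₜ₊₁) =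
  ¬T⇒¬¬InZero I Aₜ (y₁ , x₂) w∉Aₜ₊₁ λ w∈Z →
  ¬T⇒¬¬InZero I Aₜ (x₁ , y₂) z∉Aₜ₊₁ λ z∈Z →
  [ added⇒¬InZero I A t (x₁ , x₂) x∈Aₜ₊₁ x∉A
  , added⇒¬InZero I A t (y₁ , y₂) y∈Aₜ₊₁ y∉A
  ] (InZero-cross I Aₜ x₁ x₂ y₁ y₂ w∈Z z∈Z)
  where
  Aₜ : Subset
  Aₜ = Tᵗ I t A
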